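{- The matching number is stable under 2-switch: for every graph $G$ and every 2-switch $\tau$, $|\mu(\tau(G))-\mu(G)|\le 1$.
   Context: Graphs are finite, simple, undirected and labeled. $\mu(G)$ is the maximum cardinality of a set of pairwise disjoint edges of $G$. For vertices $a,b,c,d$, the 2-switch $\tau=\binom{a\ b}{c\ d}$ maps $G$ to $G-ab-cd+ac+bd$ if $ab,cd\in E(G)$, $\{a,b\}\cap\{c,d\}=\varnothing$ and $ac,bd\notin E(G)$, and to $G$ otherwise. -}

module Defs where

open import Data.Nat using (ℕ; _≤_)
open import Data.Fin using (Fin; _≟_)
open import Data.Bool using (Bool; true; false; _∧_; _∨_; not; if_then_else_)
open import Data.Product using (_×_; _,_; Σ)
open import Data.List using (List; length)
open import Data.List.Relation.Unary.All using (All)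
open import Data.List.Relation.Unary.AllPairs using (AllPairs)
open import Relation.Binary.PropositionalEquality using (_≡_; _≢_)
open import Relation.Nullary.Decidable using (⌊_⌋)

Adj : ℕ → Set
Adj n = Fin n → Fin n → Bool

record IsGraph {n : ℕ} (G : Adj n) : Set where
  field
    symmetric  : ∀ x y → G x y ≡ G y x
    irreflexive : ∀ x → G x x ≡ false

_==_ : ∀ {n} → Fin n → Fin n → Bool
x == y = ⌊ x ≟ y ⌋

sameEdge : ∀ {n} → Fin n → Fin n → Fin n → Fin n → Bool
sameEdge x y a b = (x == a ∧ y == b) ∨ (x == b ∧ y == a)

switchApplies : ∀ {n} → Adj n → Fin n → Fin n → Fin n → Fin n → Bool
switchApplies G a b c d =
  G a b ∧ G c d
  ∧ not (a == c) ∧ not (a == d) ∧ not (b == c) ∧ not (b == d)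
  ∧ not (G a c) ∧ not (G b d)

-- τ(G) for τ = (a b / c d): G - ab - cd + ac + bd if applicable, G otherwise.
twoSwitch : ∀ {n} → Fin n → Fin n → Fin n → Fin n → Adj n → Adj n
twoSwitch a b c d G x y =
  if switchApplies G a b c d
  then ((G x y ∧ not (sameEdge x y a b) ∧ not (sameEdge x y c d))
        ∨ sameEdge x y a c ∨ sameEdge x y b d)
  else G x y

DisjointEdges : ∀ {n} → Fin n × Fin n → Fin n × Fin n → Set
DisjointEdges (u , v) (u' , v') = u ≢ u' × u ≢ v' × v ≢ u' × v ≢ v'

record IsMatching {n : ℕ} (G : Adj n) (M : List (Fin n × Fin n)) : Set where
  field
    edges    : All (λ e → G (Data.Product.proj₁ e) (Data.Product.proj₂ e) ≡ true) M
    disjoint : AllPairs DisjointEdges M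

IsMatchingNumber : ∀ {n} → Adj n → ℕ → Set
IsMatchingNumber {n} G k =
  Σ (List (Fin n × Fin n)) (λ M → IsMatching G M × length M ≡ k)
  × (∀ M → IsMatching G M → length M ≤ k)

-- Let G′ arise from G by trading the edges pq and rs for pr and qs. Discarding from a matching
-- of G the edges not in G′ loses at most pq and rs, each at most once; if both are lost, their
-- four endpoints are unmatched, so pr and qs can be added back. Hence matchings shrink by at
-- most one edge. A 2-switch is such a trade in both directions (τ(G) trades ab, cd for ac, bd
-- and G trades ac, bd for ab, cd), so each matching number exceeds the other by at most one.
module Submission where

open import Defs
open import Data.Nat using (ℕ; _≤_; suc; s≤s)
open import Data.Nat.Properties using (≤-trans; ≤-reflexive; n≤1+n)
open import Data.Fin using (Fin; _≟_)
open import Data.Bool using (Bool; true; false; _∧_; _∨_; not)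
import Data.Bool as Bool
open import Data.Bool.Properties using (T-≡; T-∧; T-∨; ¬-not)
open import Data.Product using (_×_; _,_; Σ; proj₁; proj₂)
import Data.Product as Product
open import Data.Sum using (_⊎_; inj₁; inj₂)
import Data.Sum as Sum
open import Data.List using (List; []; _∷_; length; filter)
open import Data.List.Relation.Unary.All using (All; []; _∷_; lookupAny)
import Data.List.Relation.Unary.All as All
import Data.List.Relation.Unary.All.Properties as All
open import Data.List.Relation.Unary.Any using (Any; here; there)
open import Data.List.Relation.Unary.AllPairs using (AllPairs; []; _∷_)
import Data.List.Relation.Unary.AllPairs.Properties as AllPairs
open import Function.Bundles using (Equivalence)
open import Relation.Binary.PropositionalEquality using (_≡_; _≢_; refl; sym; trans; ≢-sym; cong)
open import Relation.Nullary using (¬_; yes; no; contradiction)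
open import Relation.Nullary.Decidable using (toWitness; fromWitness; toWitnessFalse)
open import Function using (_∘_)
open import Relation.Unary using (Decidable)

private
  variable
    n : ℕ

∧-true⇒ : {x y : Bool} → x ∧ y ≡ true → x ≡ true × y ≡ true
∧-true⇒ {true} h = refl , h

∨-true⇒ : {x y : Bool} → x ∨ y ≡ true → x ≡ true ⊎ y ≡ true
∨-true⇒ {true} _ = inj₁ refl
∨-true⇒ {false} h = inj₂ h

kept-unless-removed : {g : Bool} (s₁ s₂ t : Bool) → g ≡ true
  → (g ∧ not s₁ ∧ not s₂) ∨ t ≡ true ⊎ s₁ ≡ true ⊎ s₂ ≡ true
kept-unless-removed true  _     _ _    = inj₂ (inj₁ refl)
kept-unless-removed false true  _ _    = inj₂ (inj₂ refl)
kept-unless-removed false false _ refl = inj₁ refl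

∨-trueʳ : (x : Bool) {y : Bool} → y ≡ true → x ∨ y ≡ true
∨-trueʳ true _ = refl
∨-trueʳ false h = h

Edge : Adj n → Fin n × Fin n → Set
Edge G e = G (proj₁ e) (proj₂ e) ≡ true

edge⇒≢ : ∀ {G : Adj n} {x y} → IsGraph G → Edge G (x , y) → x ≢ y
edge⇒≢ gG h refl with () ← trans (sym h) (IsGraph.irreflexive gG _)

SameEdge : Fin n × Fin n → Fin n × Fin n → Set
SameEdge (x , y) (a , b) = (x ≡ a × y ≡ b) ⊎ (x ≡ b × y ≡ a)

==-refl : (x : Fin n) → x == x ≡ true
==-refl x = Equivalence.to T-≡ (fromWitness {a? = x ≟ x} refl)

not-==⇒≢ : {x y : Fin n} → not (x == y) ≡ true → x ≢ y
not-==⇒≢ {x = x} {y} h = toWitnessFalse {a? = x ≟ y} (Equivalence.from T-≡ h)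

sameEdge-sound : {x y a b : Fin n} → sameEdge x y a b ≡ true → SameEdge (x , y) (a , b)
sameEdge-sound {x = x} {y} {a} {b} h =
  Sum.map (Product.map (toWitness {a? = x ≟ a}) (toWitness {a? = y ≟ b}) ∘ Equivalence.to T-∧)
          (Product.map (toWitness {a? = x ≟ b}) (toWitness {a? = y ≟ a}) ∘ Equivalence.to T-∧)
          (Equivalence.to T-∨ (Equivalence.from T-≡ h))

sameEdge-refl : (x y : Fin n) → sameEdge x y x y ≡ true
sameEdge-refl x y rewrite ==-refl x | ==-refl y = refl

DisjointEdges-sym : {e f : Fin n × Fin n} → DisjointEdges e f → DisjointEdges f e
DisjointEdges-sym (u≢u′ , u≢v′ , v≢u′ , v≢v′) = ≢-sym u≢u′ , ≢-sym v≢u′ , ≢-sym u≢v′ , ≢-sym v≢v′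

DisjointEdges-irrefl : (e : Fin n × Fin n) → ¬ DisjointEdges e e
DisjointEdges-irrefl e (u≢u , _) = u≢u refl

DisjointEdges-respʳ : {e f f′ : Fin n × Fin n} → SameEdge f f′ → DisjointEdges e f → DisjointEdges e f′
DisjointEdges-respʳ (inj₁ (refl , refl)) d = d
DisjointEdges-respʳ (inj₂ (refl , refl)) (u≢u′ , u≢v′ , v≢u′ , v≢v′) = u≢v′ , u≢u′ , v≢v′ , v≢u′

SameEdge⇒¬DisjointEdges : {e f x : Fin n × Fin n} → SameEdge e x → SameEdge f x → ¬ DisjointEdges e f
SameEdge⇒¬DisjointEdges {x = x} e≈x f≈x d =
  DisjointEdges-irrefl x
    (DisjointEdges-respʳ f≈x (DisjointEdges-sym (DisjointEdges-respʳ e≈x (DisjointEdges-sym d))))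

_∈ₑ_ : Fin n × Fin n → List (Fin n × Fin n) → Set
x ∈ₑ L = Any (λ f → SameEdge f x) L

Avoids : List (Fin n × Fin n) → Fin n × Fin n → Set
Avoids L x = All (λ f → DisjointEdges f x) L

All-disjoint-∈ₑ : ∀ {e x : Fin n × Fin n} {L} → All (DisjointEdges e) L → x ∈ₑ L → DisjointEdges e x
All-disjoint-∈ₑ ds x∈L with d , f≈x ← lookupAny ds x∈L = DisjointEdges-respʳ f≈x d

All-disjoint-∉ₑ : ∀ {e x : Fin n × Fin n} {L} → SameEdge e x → All (DisjointEdges e) L → ¬ x ∈ₑ L
All-disjoint-∉ₑ e≈x ds x∈L with d , f≈x ← lookupAny ds x∈L = SameEdge⇒¬DisjointEdges e≈x f≈x d

MatchingsLoseAtMostOne : Adj n → Adj n → Set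
MatchingsLoseAtMostOne {n} G G′ =
  ∀ L → IsMatching G L → Σ (List (Fin n × Fin n)) λ M → IsMatching G′ M × length L ≤ suc (length M)

MatchingsLoseAtMostOne-⊆ : {G G′ : Adj n} → (∀ {e} → Edge G e → Edge G′ e) → MatchingsLoseAtMostOne G G′
MatchingsLoseAtMostOne-⊆ G⊆G′ L L-matching =
  L , record { edges = All.map G⊆G′ (IsMatching.edges L-matching) ; disjoint = IsMatching.disjoint L-matching }
    , n≤1+n (length L)

matchingNumber-≤-suc : {G G′ : Adj n} {k m : ℕ} → MatchingsLoseAtMostOne G G′
  → IsMatchingNumber G k → IsMatchingNumber G′ m → k ≤ suc m
matchingNumber-≤-suc lose ((L , L-matching , refl) , _) (_ , maximal)
  with M , M-matching , L≤1+M ← lose L L-matching = ≤-trans L≤1+M (s≤s (maximal M M-matching))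

module _ (H : Adj n) (p q r s : Fin n) where

  Allowed : Fin n × Fin n → Set
  Allowed e = Edge H e ⊎ SameEdge e (p , q) ⊎ SameEdge e (r , s)

  private
    edge? : Decidable (Edge H)
    edge? e = H (proj₁ e) (proj₂ e) Bool.≟ true

    kept : List (Fin n × Fin n) → List (Fin n × Fin n)
    kept = filter edge?

  -- K is L without some edges equal to pq or rs; the constructor records which ones.
  data Dropped (L K : List (Fin n × Fin n)) : Set where
    dropped-none : length L ≡ length K → Dropped L K
    dropped-pq   : length L ≡ suc (length K) → (p , q) ∈ₑ L → Avoids K (p , q) → Dropped L K
    dropped-rs   : length L ≡ suc (length K) → (r , s) ∈ₑ L → Avoids K (r , s) → Dropped L K
    dropped-both : length L ≡ suc (suc (length K)) → (p , q) ∈ₑ L → (r , s) ∈ₑ L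
                 → Avoids K (p , q) → Avoids K (r , s) → Dropped L K

  Dropped-keep : ∀ {e L K} → All (DisjointEdges e) L → Dropped L K → Dropped (e ∷ L) (e ∷ K)
  Dropped-keep e-L (dropped-none eq) = dropped-none (cong suc eq)
  Dropped-keep e-L (dropped-pq eq ∈L av) = dropped-pq (cong suc eq) (there ∈L) (All-disjoint-∈ₑ e-L ∈L ∷ av)
  Dropped-keep e-L (dropped-rs eq ∈L av) = dropped-rs (cong suc eq) (there ∈L) (All-disjoint-∈ₑ e-L ∈L ∷ av)
  Dropped-keep e-L (dropped-both eq ∈L ∈L′ av av′) =
    dropped-both (cong suc eq) (there ∈L) (there ∈L′) (All-disjoint-∈ₑ e-L ∈L ∷ av) (All-disjoint-∈ₑ e-L ∈L′ ∷ av′)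

  kept-isMatching : ∀ L → AllPairs DisjointEdges L → IsMatching H (kept L)
  kept-isMatching L L-disjoint = record { edges = All.all-filter edge? L ; disjoint = AllPairs.filter⁺ edge? L-disjoint }

  kept-avoids : ∀ {e x L} → SameEdge e x → All (DisjointEdges e) L → Avoids (kept L) x
  kept-avoids e≈x e-L = All.filter⁺ edge? (All.map (λ d → DisjointEdges-respʳ e≈x (DisjointEdges-sym d)) e-L)

  Dropped-drop : ∀ {e L} → All (DisjointEdges e) L → SameEdge e (p , q) ⊎ SameEdge e (r , s)
    → Dropped L (kept L) → Dropped (e ∷ L) (kept L)
  Dropped-drop e-L (inj₁ e≈pq) (dropped-none eq) = dropped-pq (cong suc eq) (here e≈pq) (kept-avoids e≈pq e-L)
  Dropped-drop e-L (inj₁ e≈pq) (dropped-pq _ ∈L _) = contradiction ∈L (All-disjoint-∉ₑ e≈pq e-L)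
  Dropped-drop e-L (inj₁ e≈pq) (dropped-rs eq ∈L av) =
    dropped-both (cong suc eq) (here e≈pq) (there ∈L) (kept-avoids e≈pq e-L) av
  Dropped-drop e-L (inj₁ e≈pq) (dropped-both _ ∈L _ _ _) = contradiction ∈L (All-disjoint-∉ₑ e≈pq e-L)
  Dropped-drop e-L (inj₂ e≈rs) (dropped-none eq) = dropped-rs (cong suc eq) (here e≈rs) (kept-avoids e≈rs e-L)
  Dropped-drop e-L (inj₂ e≈rs) (dropped-pq eq ∈L av) =
    dropped-both (cong suc eq) (there ∈L) (here e≈rs) av (kept-avoids e≈rs e-L)
  Dropped-drop e-L (inj₂ e≈rs) (dropped-rs _ ∈L _) = contradiction ∈L (All-disjoint-∉ₑ e≈rs e-L)
  Dropped-drop e-L (inj₂ e≈rs) (dropped-both _ _ ∈L _ _) = contradiction ∈L (All-disjoint-∉ₑ e≈rs e-L)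

  Dropped-kept : ∀ L → AllPairs DisjointEdges L → All Allowed L → Dropped L (kept L)
  Dropped-kept [] [] [] = dropped-none refl
  Dropped-kept (e ∷ L) (e-L ∷ L-disjoint) (e-allowed ∷ L-allowed) with edge? e | e-allowed
  ... | yes _ | _ = Dropped-keep e-L (Dropped-kept L L-disjoint L-allowed)
  ... | no e∉H | inj₁ e∈H = contradiction e∈H e∉H
  ... | no _ | inj₂ removed = Dropped-drop e-L removed (Dropped-kept L L-disjoint L-allowed)

  private
    avoiding-both : ∀ {f} → DisjointEdges f (p , q) → DisjointEdges f (r , s)
      → DisjointEdges (p , r) f × DisjointEdges (q , s) f
    avoiding-both (u≢p , u≢q , v≢p , v≢q) (u≢r , u≢s , v≢r , v≢s) =
      (≢-sym u≢p , ≢-sym v≢p , ≢-sym u≢r , ≢-sym v≢r) , (≢-sym u≢q , ≢-sym v≢q , ≢-sym u≢s , ≢-sym v≢s)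

  exchange-loses-at-most-one : Edge H (p , r) → Edge H (q , s) → DisjointEdges (p , r) (q , s)
    → (G : Adj n) → (∀ {e} → Edge G e → Allowed e) → MatchingsLoseAtMostOne G H
  exchange-loses-at-most-one pr∈H qs∈H pr-qs G allowed L L-matching
    with Dropped-kept L (IsMatching.disjoint L-matching) (All.map allowed (IsMatching.edges L-matching))
       | kept-isMatching L (IsMatching.disjoint L-matching)
  ... | dropped-none eq | K-matching = kept L , K-matching , ≤-trans (≤-reflexive eq) (n≤1+n _)
  ... | dropped-pq eq _ _ | K-matching = kept L , K-matching , ≤-reflexive eq
  ... | dropped-rs eq _ _ | K-matching = kept L , K-matching , ≤-reflexive eq
  ... | dropped-both eq _ _ av av′ | K-matching =
    (p , r) ∷ (q , s) ∷ kept L ,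
    record { edges = pr∈H ∷ qs∈H ∷ IsMatching.edges K-matching
           ; disjoint = (pr-qs ∷ All.map proj₁ frees) ∷ All.map proj₂ frees ∷ IsMatching.disjoint K-matching } ,
    ≤-trans (≤-reflexive eq) (n≤1+n _)
    where
    frees : All (λ f → DisjointEdges (p , r) f × DisjointEdges (q , s) f) (kept L)
    frees = All.zipWith (λ (d , d′) → avoiding-both d d′) (av , av′)

module _ (G : Adj n) (a b c d : Fin n) where

  twoSwitch-applied : switchApplies G a b c d ≡ true → ∀ x y → twoSwitch a b c d G x y ≡
    (G x y ∧ not (sameEdge x y a b) ∧ not (sameEdge x y c d)) ∨ sameEdge x y a c ∨ sameEdge x y b d
  twoSwitch-applied h x y rewrite h = refl

  twoSwitch-idle : switchApplies G a b c d ≡ false → ∀ x y → twoSwitch a b c d G x y ≡ G x y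
  twoSwitch-idle h x y rewrite h = refl

  S : Adj n
  S = twoSwitch a b c d G

  module _ (applies : switchApplies G a b c d ≡ true) where

    switchApplies-sound : Edge G (a , b) × Edge G (c , d) × DisjointEdges (a , b) (c , d)
    switchApplies-sound =
      let ab , h₁ = ∧-true⇒ applies
          cd , h₂ = ∧-true⇒ h₁
          a≢c , h₃ = ∧-true⇒ h₂
          a≢d , h₄ = ∧-true⇒ h₃
          b≢c , h₅ = ∧-true⇒ h₄
          b≢d , _ = ∧-true⇒ h₅
      in ab , cd , not-==⇒≢ a≢c , not-==⇒≢ a≢d , not-==⇒≢ b≢c , not-==⇒≢ b≢d

    added-edge : ∀ {x y} → sameEdge x y a c ∨ sameEdge x y b d ≡ true → Edge S (x , y)
    added-edge {x} {y} h = trans (twoSwitch-applied applies x y)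
      (∨-trueʳ (G x y ∧ not (sameEdge x y a b) ∧ not (sameEdge x y c d)) h)

    switched-edge⇒ : ∀ {e} → Edge S e → Edge G e ⊎ SameEdge e (a , c) ⊎ SameEdge e (b , d)
    switched-edge⇒ {u , v} uv∈S =
      Sum.map (proj₁ ∘ ∧-true⇒) (Sum.map sameEdge-sound sameEdge-sound ∘ ∨-true⇒)
        (∨-true⇒ (trans (sym (twoSwitch-applied applies u v)) uv∈S))

    edge⇒switched : ∀ {e} → Edge G e → Edge S e ⊎ SameEdge e (a , b) ⊎ SameEdge e (c , d)
    edge⇒switched {u , v} uv∈G =
      Sum.map (trans (twoSwitch-applied applies u v)) (Sum.map sameEdge-sound sameEdge-sound)
        (kept-unless-removed (sameEdge u v a b) (sameEdge u v c d) _ uv∈G)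

  twoSwitch-loses-at-most-one : IsGraph G → MatchingsLoseAtMostOne G S × MatchingsLoseAtMostOne S G
  twoSwitch-loses-at-most-one gG with switchApplies G a b c d Bool.≟ true
  ... | no does-not-apply =
    MatchingsLoseAtMostOne-⊆ (trans (twoSwitch-idle (¬-not does-not-apply) _ _)) ,
    MatchingsLoseAtMostOne-⊆ (trans (sym (twoSwitch-idle (¬-not does-not-apply) _ _)))
  ... | yes applies with ab , cd , a≢c , a≢d , b≢c , b≢d ← switchApplies-sound applies =
    exchange-loses-at-most-one S a b c d (added-edge applies (cong (_∨ sameEdge a c b d) (sameEdge-refl a c)))
      (added-edge applies (∨-trueʳ (sameEdge b d a c) (sameEdge-refl b d)))
      (edge⇒≢ gG ab , a≢d , ≢-sym b≢c , edge⇒≢ gG cd) G (edge⇒switched applies) ,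
    exchange-loses-at-most-one G a c b d ab cd (a≢c , a≢d , b≢c , b≢d) S (switched-edge⇒ applies)

theorem9 : ∀ {n} (G : Adj n) → IsGraph G → (a b c d : Fin n) → (k m : ℕ)
    → IsMatchingNumber G k → IsMatchingNumber (twoSwitch a b c d G) m
    → (m ≤ suc k) × (k ≤ suc m)
theorem9 G gG a b c d k m μG μS =
  let G→S , S→G = twoSwitch-loses-at-most-one G a b c d gG
  in matchingNumber-≤-suc S→G μS μG , matchingNumber-≤-suc G→S μG μS
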